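{- Let $q\ge5$, let $\mu\in\mathbb{F}_q^*\setminus\{1\}$ if $q$ is even or $q\equiv0\pmod3$, and $\mu\in\mathbb{F}_q^*\setminus\{1,1/9\}$ if $q$ is odd and $q\not\equiv0\pmod3$. Let $\ell_\mu$ be the line through $\mathbf{P}(0,\mu,0,1)$ and $\mathbf{P}(1,0,1,0)$, and let $\widetilde N_1(\mu)$ be the number of $c\in\mathbb{F}_q^*$ such that $t^3+ct^2-t-\mu c=0$ has exactly one solution $t\in\mathbb{F}_q$. Then the number of $\overline{1_{\mathcal{C}}}$-planes containing $\ell_\mu$ equals $\widetilde N_1(\mu)$ if $\mu$ is a square in $\mathbb{F}_q$, and $\widetilde N_1(\mu)+1$ otherwise.
   Context: $\mathbf{P}(x_0,\dots,x_3)$ is a point of $\mathrm{PG}(3,q)$, $\boldsymbol{\pi}(c_0,\dots,c_3)$ the plane $\sum c_ix_i=0$. Twisted cubic $\mathcal{C}=\{\mathbf{P}(t^3,t^2,t,1):t\in\mathbb{F}_q\}\cup\{\mathbf{P}(1,0,0,0)\}$. Osculating planes: $\boldsymbol{\pi}(1,-3t,3t^2,-t^3)$, $t\in\mathbb{F}_q$, and $\boldsymbol{\pi}(0,0,0,1)$. A $\overline{1_{\mathcal{C}}}$-plane is a plane that is not an osculating plane and contains exactly one point of $\mathcal{C}$. -}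

module Defs where

open import Level using (0ℓ)
open import Data.Nat as ℕ using (ℕ)
open import Data.Bool using (Bool; true; false; not; _∧_; _∨_)
open import Data.List using (List; []; _∷_; length; filterᵇ; map; concatMap)
open import Data.Bool.ListAction using (all; any)
open import Data.List.Membership.Propositional using (_∈_)
open import Data.List.Relation.Unary.Unique.Propositional using (Unique)
open import Data.Product using (∃; _×_; _,_)
open import Relation.Nullary using (¬_; does)
open import Relation.Binary.PropositionalEquality using (_≡_)
open import Relation.Binary.Definitions using (DecidableEquality)

open import Algebra.Structures using (IsCommutativeRing)

record FiniteField : Set₁ where
  infixl 6 _+_
  infixl 7 _*_
  field
    Carrier  : Set
    _+_ _*_  : Carrier → Carrier → Carrier
    -_       : Carrier → Carrier
    0# 1#    : Carrier
    isCommutativeRing : IsCommutativeRing _≡_ _+_ _*_ -_ 0# 1#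
    0≢1      : ¬ (0# ≡ 1#)
    inverse  : ∀ x → ¬ (x ≡ 0#) → ∃ λ y → x * y ≡ 1#
    _≟_      : DecidableEquality Carrier
    elements : List Carrier
    complete : ∀ x → x ∈ elements
    unique   : Unique elements

module _ (F : FiniteField) where
  open FiniteField F

  order : ℕ
  order = length elements

  _==_ : Carrier → Carrier → Bool
  x == y = does (x ≟ y)

  infixl 6 _-_
  _-_ : Carrier → Carrier → Carrier
  x - y = x + (- y)

  fromℕ : ℕ → Carrier
  fromℕ ℕ.zero = 0#
  fromℕ (ℕ.suc n) = 1# + fromℕ n

  count : {A : Set} → (A → Bool) → List A → ℕ
  count p xs = length (filterᵇ p xs)

  record V4 : Set where
    constructor v4
    field c0 c1 c2 c3 : Carrier

  allV4 : List V4
  allV4 = concatMap (λ a → concatMap (λ b →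
            concatMap (λ c → map (λ d → v4 a b c d) elements)
            elements) elements) elements

  isZeroV : V4 → Bool
  isZeroV (v4 a b c d) = (a == 0#) ∧ (b == 0#) ∧ (c == 0#) ∧ (d == 0#)

  -- normalised representative of a projective point / plane:
  -- nonzero vector whose first nonzero coordinate equals 1.
  -- Each point (resp. plane) of PG(3,q) has exactly one such representative.
  isNormalised : V4 → Bool
  isNormalised (v4 a b c d) =
    if' (a == 0#) (if' (b == 0#) (if' (c == 0#) (d == 1#) (c == 1#)) (b == 1#)) (a == 1#)
    where
      if' : Bool → Bool → Bool → Bool
      if' true  x _ = x
      if' false _ y = y

  scale : Carrier → V4 → V4
  scale k (v4 a b c d) = v4 (k * a) (k * b) (k * c) (k * d)

  addV : V4 → V4 → V4
  addV (v4 a b c d) (v4 a' b' c' d') = v4 (a + a') (b + b') (c + c') (d + d')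

  sameProj : V4 → V4 → Bool
  sameProj u v = any (λ k → not (k == 0#) ∧ isZeroV (addV u (scale (- k) v))) elements

  onPlane : V4 → V4 → Bool
  onPlane (v4 c0 c1 c2 c3) (v4 x0 x1 x2 x3) =
    (c0 * x0 + c1 * x1 + c2 * x2 + c3 * x3) == 0#

  containsLine : V4 → V4 → V4 → Bool
  containsLine π P Q =
    all (λ a → all (λ b → onPlane π (addV (scale a P) (scale b Q))) elements) elements

  -- the twisted cubic C, listed by one representative per point
  cubicPoints : List V4
  cubicPoints = v4 1# 0# 0# 0# ∷ map (λ t → v4 (t * t * t) (t * t) t 1#) elements

  osculatingPlanes : List V4
  osculatingPlanes =
    v4 0# 0# 0# 1# ∷ map (λ t → v4 1# (- (fromℕ 3 * t)) (fromℕ 3 * t * t) (- (t * t * t))) elements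

  isOsculating : V4 → Bool
  isOsculating π = any (sameProj π) osculatingPlanes

  pointsOfC : V4 → ℕ
  pointsOfC π = count (onPlane π) cubicPoints

  isOneBarPlane : V4 → Bool
  isOneBarPlane π = not (isOsculating π) ∧ does (pointsOfC π ℕ.≟ 1)

  Pμ : Carrier → V4
  Pμ μ = v4 0# μ 0# 1#

  P1010 : V4
  P1010 = v4 1# 0# 1# 0#

  numOneBarPlanesThrough : Carrier → ℕ
  numOneBarPlanesThrough μ =
    count (λ π → isNormalised π ∧ containsLine π (Pμ μ) P1010 ∧ isOneBarPlane π) allV4

  numRoots : Carrier → Carrier → ℕ
  numRoots μ c = count (λ t → (((t * t * t + c * t * t) - t) - μ * c) == 0#) elements

  Ñ₁ : Carrier → ℕ
  Ñ₁ μ = count (λ c → not (c == 0#) ∧ does (numRoots μ c ℕ.≟ 1)) elements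

  IsSquare : Carrier → Set
  IsSquare μ = ∃ λ x → x * x ≡ μ

-- Every plane through ℓ_μ is π(a, b, −a, −μb); up to scalars these are π_b = π(1, b, −1, −μb)
-- for b ∈ F_q and π∞ = π(0, 1, 0, −μ).  The plane π_b misses P(1,0,0,0) and contains P(t³,t²,t,1)
-- exactly when t³ + bt² − t − μb = 0; it is never osculating, since coinciding with the osculating
-- plane at t means b = −3t, 3t² = −1 and μb = t³, whence 9μ = 1.  For b = 0 the cubic has the two
-- roots 0 and 1, so the planes π_b contribute exactly Ñ₁(μ).  The plane π∞ is not osculating and
-- meets 𝒞 in P(1,0,0,0) and in the points with t² = μ, so it is a 1̄-plane iff μ is a non-square.
-- The hypothesis 9μ ≠ 1 is given only when q is prime to 6; in characteristic 2 and 3 it follows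
-- from μ ≠ 1 and from 9 = 0.  Passing from q to the characteristic is an orbit count: x ↦ −x acts
-- freely on F_q^*, and (x, y) ↦ (y, −x − y) acts with orbits of size 3 on F_q² ∖ {0}.

module Submission where

open import Algebra.Bundles using (CommutativeRing)
open import Data.Nat as ℕ using (ℕ; zero; suc; _≤_; _%_; s≤s)
import Data.Nat.Properties as ℕ
open import Data.Nat.Divisibility using (_∣_; _∣0; ∣-refl; ∣m∣n⇒∣m+n; ∣m+n∣m⇒∣n; ∣1⇒≡1; ∣m⇒∣m*n; m%n≡0⇒n∣m)
open import Data.Integer as ℤ using (ℤ; -[1+_]; _⊖_; _◃_; sign; ∣_∣)
import Data.Integer.Properties as ℤ
open import Data.Sign as Sign using (Sign)
open import Data.Bool using (Bool; true; false; not; T; _∧_; if_then_else_)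
open import Data.Bool.Properties using (T-∧)
open import Data.Maybe using (Maybe; just; nothing)
open import Data.Product using (∃; _×_; _,_; proj₁; proj₂)
open import Data.Sum using (_⊎_; inj₁; inj₂; [_,_]′)
open import Data.List using (List; []; _∷_; [_]; length; filter; filterᵇ; map; concatMap; cartesianProduct)
open import Data.Nat.ListAction using (sum)
open import Data.Nat.ListAction.Properties using (sum-++)
import Data.List.Properties as List
open import Data.List.Membership.Propositional using (_∈_)
open import Data.List.Membership.Propositional.Properties using (∈-filter⁺; ∈-filter⁻; ∈-length; ∈-map⁺; ∈-cartesianProduct⁺)
open import Data.List.Membership.Propositional.Properties.WithK using (unique∧set⇒bag)
open import Data.List.Relation.Binary.BagAndSetEquality using (∼bag⇒↭)
open import Data.List.Relation.Binary.Permutation.Propositional.Properties using (↭-length)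
open import Data.List.Relation.Binary.Subset.Propositional using (_⊆_)
open import Data.List.Relation.Unary.Any using (here; there; satisfied)
open import Data.List.Relation.Unary.Any.Properties using (any⁻; map⁻)
open import Data.List.Relation.Unary.All.Properties using (all⁺; all⁻)
open import Data.Bool.ListAction using (all; any)
open import Data.List.Relation.Unary.All as All using (All; []; _∷_)
open import Data.List.Relation.Unary.Unique.Propositional using (Unique; []; _∷_)
import Data.List.Relation.Unary.Unique.Propositional.Properties as Unique
open import Function using (_∘_; mk⇔; case_of_; Equivalence)
open import Relation.Nullary using (¬_; yes; no; does; contradiction)
open import Relation.Nullary.Decidable using (dec-true; dec-false; T?)
open import Relation.Unary using (Pred; Decidable)
open import Relation.Unary.Properties using (∁?)
open import Relation.Binary.Definitions using (DecidableEquality)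
import Relation.Binary.PropositionalEquality as ≡
open ≡ using (_≡_; _≢_)
import Algebra.Solver.Ring.AlmostCommutativeRing as ACR

open import Defs

-- Algebra.Solver.Ring needs a coefficient ring with decidable equality; ℤ maps into every
-- commutative ring.
module IntegerCoefficientRingSolver {c ℓ} (R : CommutativeRing c ℓ) where
  open CommutativeRing R hiding (_-_)
  open import Algebra.Properties.Ring ring using (-0#≈0#; -‿involutive; -‿distribˡ-*; -‿+-comm)
  open import Algebra.Properties.CommutativeSemigroup +-commutativeSemigroup using (interchange)
  open import Algebra.Properties.CommutativeSemigroup *-commutativeSemigroup using () renaming (interchange to *-interchange)
  open import Algebra.Properties.Semiring.Mult.TCOptimised semiring using (×-homo-+; ×1-homo-*) renaming (_×_ to _×ₙ_)
  open import Relation.Binary.Reasoning.Setoid setoid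

  private
    ⟦_⟧ : ℤ → Carrier
    ⟦ ℤ.+ n ⟧ = n ×ₙ 1#
    ⟦ -[1+ n ] ⟧ = - (suc n ×ₙ 1#)

    suc×1 : ∀ n → suc n ×ₙ 1# ≈ 1# + n ×ₙ 1#
    suc×1 n = ×-homo-+ 1# 1 n

    ⊖-homo : ∀ m n → ⟦ m ⊖ n ⟧ ≈ m ×ₙ 1# + - (n ×ₙ 1#)
    ⊖-homo zero zero = sym (trans (+-identityˡ _) -0#≈0#)
    ⊖-homo zero (suc n) = sym (+-identityˡ _)
    ⊖-homo (suc m) zero = sym (trans (+-congˡ -0#≈0#) (+-identityʳ _))
    ⊖-homo (suc m) (suc n) = begin
      ⟦ suc m ⊖ suc n ⟧                        ≡⟨ ≡.cong ⟦_⟧ (ℤ.[1+m]⊖[1+n]≡m⊖n m n) ⟩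
      ⟦ m ⊖ n ⟧                                ≈⟨ ⊖-homo m n ⟩
      m ×ₙ 1# + - (n ×ₙ 1#)                    ≈⟨ +-identityˡ _ ⟨
      0# + (m ×ₙ 1# + - (n ×ₙ 1#))             ≈⟨ +-congʳ (-‿inverseʳ 1#) ⟨
      (1# + - 1#) + (m ×ₙ 1# + - (n ×ₙ 1#))    ≈⟨ interchange 1# (- 1#) (m ×ₙ 1#) (- (n ×ₙ 1#)) ⟩
      (1# + m ×ₙ 1#) + (- 1# + - (n ×ₙ 1#))    ≈⟨ +-congˡ (-‿+-comm 1# (n ×ₙ 1#)) ⟩
      (1# + m ×ₙ 1#) + - (1# + n ×ₙ 1#)        ≈⟨ +-cong (suc×1 m) (-‿cong (suc×1 n)) ⟨
      suc m ×ₙ 1# + - (suc n ×ₙ 1#)            ∎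

    +-homo : ∀ i j → ⟦ i ℤ.+ j ⟧ ≈ ⟦ i ⟧ + ⟦ j ⟧
    +-homo (ℤ.+ m) (ℤ.+ n) = ×-homo-+ 1# m n
    +-homo (ℤ.+ m) -[1+ n ] = ⊖-homo m (suc n)
    +-homo -[1+ m ] (ℤ.+ n) = trans (⊖-homo n (suc m)) (+-comm _ _)
    +-homo -[1+ m ] -[1+ n ] = begin
      - (suc (suc (m ℕ.+ n)) ×ₙ 1#)        ≡⟨ ≡.cong (λ k → - (suc k ×ₙ 1#)) (ℕ.+-suc m n) ⟨
      - ((suc m ℕ.+ suc n) ×ₙ 1#)          ≈⟨ -‿cong (×-homo-+ 1# (suc m) (suc n)) ⟩
      - (suc m ×ₙ 1# + suc n ×ₙ 1#)        ≈⟨ -‿+-comm _ _ ⟨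
      - (suc m ×ₙ 1#) + - (suc n ×ₙ 1#)    ∎

    signed : Sign → Carrier
    signed Sign.+ = 1#
    signed Sign.- = - 1#

    ◃-homo : ∀ s n → ⟦ s ◃ n ⟧ ≈ signed s * n ×ₙ 1#
    ◃-homo s zero = sym (zeroʳ _)
    ◃-homo Sign.+ (suc n) = sym (*-identityˡ _)
    ◃-homo Sign.- (suc n) = trans (-‿cong (sym (*-identityˡ _))) (-‿distribˡ-* 1# _)

    signed-homo : ∀ s t → signed (s Sign.* t) ≈ signed s * signed t
    signed-homo Sign.+ t = sym (*-identityˡ _)
    signed-homo Sign.- Sign.+ = sym (*-identityʳ _)
    signed-homo Sign.- Sign.- = begin
      1#              ≈⟨ -‿involutive 1# ⟨
      - - 1#          ≈⟨ -‿cong (*-identityˡ (- 1#)) ⟨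
      - (1# * - 1#)   ≈⟨ -‿distribˡ-* 1# (- 1#) ⟩
      - 1# * - 1#     ∎

    *-homo : ∀ i j → ⟦ i ℤ.* j ⟧ ≈ ⟦ i ⟧ * ⟦ j ⟧
    *-homo i j = begin
      ⟦ sign i Sign.* sign j ◃ ∣ i ∣ ℕ.* ∣ j ∣ ⟧
        ≈⟨ ◃-homo (sign i Sign.* sign j) (∣ i ∣ ℕ.* ∣ j ∣) ⟩
      signed (sign i Sign.* sign j) * (∣ i ∣ ℕ.* ∣ j ∣) ×ₙ 1#
        ≈⟨ *-cong (signed-homo (sign i) (sign j)) (×1-homo-* ∣ i ∣ ∣ j ∣) ⟩
      (signed (sign i) * signed (sign j)) * (∣ i ∣ ×ₙ 1# * ∣ j ∣ ×ₙ 1#)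
        ≈⟨ *-interchange _ _ _ _ ⟩
      (signed (sign i) * ∣ i ∣ ×ₙ 1#) * (signed (sign j) * ∣ j ∣ ×ₙ 1#)
        ≈⟨ *-cong (sign-abs i) (sign-abs j) ⟨
      ⟦ i ⟧ * ⟦ j ⟧
        ∎
      where
      sign-abs : ∀ k → ⟦ k ⟧ ≈ signed (sign k) * ∣ k ∣ ×ₙ 1#
      sign-abs k = trans (reflexive (≡.cong ⟦_⟧ (≡.sym (ℤ.◃-inverse k)))) (◃-homo (sign k) ∣ k ∣)

    neg-homo : ∀ i → ⟦ ℤ.- i ⟧ ≈ - ⟦ i ⟧
    neg-homo (ℤ.+ zero) = sym -0#≈0#
    neg-homo (ℤ.+ suc n) = refl
    neg-homo -[1+ n ] = sym (-‿involutive _)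

    morphism : ℤ.+-*-rawRing ACR.-Raw-AlmostCommutative⟶ ACR.fromCommutativeRing R
    morphism = record
      { ⟦_⟧ = ⟦_⟧ ; +-homo = +-homo ; *-homo = *-homo ; -‿homo = neg-homo ; 0-homo = refl ; 1-homo = refl }

    equal? : ∀ i j → Maybe (⟦ i ⟧ ≈ ⟦ j ⟧)
    equal? i j with i ℤ.≟ j
    ... | yes ≡.refl = just refl
    ... | no _ = nothing

  open import Algebra.Solver.Ring ℤ.+-*-rawRing (ACR.fromCommutativeRing R) morphism equal? public
    using (Polynomial; solve; _:+_; _:*_; :-_; con; _:=_)

  :0 :1 : ∀ {n} → Polynomial n
  :0 = con (ℤ.+ 0)
  :1 = con (ℤ.+ 1)

indicator : Bool → ℕ
indicator b = if b then 1 else 0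

T-all : ∀ {a} {A : Set a} {p : A → Bool} {xs x} → T (all p xs) → x ∈ xs → T (p x)
T-all {p = p} {xs} all-p x∈xs = All.lookup (all⁺ p xs all-p) x∈xs

T-∧⁻ : ∀ {x y} → T (x ∧ y) → T x × T y
T-∧⁻ = Equivalence.to T-∧

T⇒∧-identityˡ : ∀ {x y} → T x → x ∧ y ≡ y
T⇒∧-identityˡ {true} _ = ≡.refl

¬T⇒≡false : ∀ {b} → ¬ T b → b ≡ false
¬T⇒≡false {true} ¬T = contradiction _ ¬T
¬T⇒≡false {false} _ = ≡.refl

indicator-false : ∀ {b} → ¬ T b → indicator b ≡ 0
indicator-false = ≡.cong indicator ∘ ¬T⇒≡false

module _ {a} {A : Set a} where
  open import Data.Nat using (_+_)

  sumOver : List A → (A → ℕ) → ℕ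
  sumOver xs f = sum (map f xs)

  length-filterᵇ : ∀ (p : A → Bool) xs → length (filterᵇ p xs) ≡ sumOver xs (indicator ∘ p)
  length-filterᵇ p [] = ≡.refl
  length-filterᵇ p (x ∷ xs) with p x
  ... | true = ≡.cong suc (length-filterᵇ p xs)
  ... | false = length-filterᵇ p xs

  sumOver-cong : ∀ xs {f g : A → ℕ} → (∀ x → f x ≡ g x) → sumOver xs f ≡ sumOver xs g
  sumOver-cong xs f≗g = ≡.cong sum (List.map-cong f≗g xs)

  length-filterᵇ-cong : ∀ {p q : A → Bool} xs → (∀ x → p x ≡ q x) → length (filterᵇ p xs) ≡ length (filterᵇ q xs)
  length-filterᵇ-cong {p} {q} xs p≗q =
    ≡.trans (length-filterᵇ p xs) (≡.trans (sumOver-cong xs (≡.cong indicator ∘ p≗q)) (≡.sym (length-filterᵇ q xs)))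

  sumOver-zero : ∀ {xs} {f : A → ℕ} → (∀ {x} → x ∈ xs → f x ≡ 0) → sumOver xs f ≡ 0
  sumOver-zero {[]} _ = ≡.refl
  sumOver-zero {x ∷ xs} f≡0 = ≡.cong₂ _+_ (f≡0 (here ≡.refl)) (sumOver-zero (f≡0 ∘ there))

  sumOver-point : ∀ {xs} {f : A → ℕ} {k} → Unique xs → k ∈ xs →
                  (∀ {x} → x ∈ xs → x ≢ k → f x ≡ 0) → sumOver xs f ≡ f k
  sumOver-point {x ∷ xs} {f} (x∉xs ∷ _) (here ≡.refl) f≡0 =
    ≡.trans (≡.cong (f x +_) (sumOver-zero λ y∈xs → f≡0 (there y∈xs) (≡.≢-sym (All.lookup x∉xs y∈xs))))
            (ℕ.+-identityʳ (f x))
  sumOver-point (x∉xs ∷ xs!) (there k∈xs) f≡0 =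
    ≡.cong₂ _+_ (f≡0 (here ≡.refl) (All.lookup x∉xs k∈xs)) (sumOver-point xs! k∈xs (f≡0 ∘ there))

  sumOver-two-points : ∀ {xs} {f : A → ℕ} {k l} → Unique xs → k ∈ xs → l ∈ xs → k ≢ l →
                       (∀ {x} → x ∈ xs → x ≢ k → x ≢ l → f x ≡ 0) → sumOver xs f ≡ f k + f l
  sumOver-two-points _ (here ≡.refl) (here ≡.refl) k≢l _ = contradiction ≡.refl k≢l
  sumOver-two-points {f = f} {k} (x∉xs ∷ xs!) (here ≡.refl) (there l∈xs) _ f≡0 =
    ≡.cong (f k +_) (sumOver-point xs! l∈xs λ y∈xs → f≡0 (there y∈xs) (≡.≢-sym (All.lookup x∉xs y∈xs)))
  sumOver-two-points {f = f} {k} {l} (x∉xs ∷ xs!) (there k∈xs) (here ≡.refl) _ f≡0 =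
    ≡.trans (≡.cong (f l +_) (sumOver-point xs! k∈xs λ y∈xs y≢k → f≡0 (there y∈xs) y≢k (≡.≢-sym (All.lookup x∉xs y∈xs))))
            (ℕ.+-comm (f l) (f k))
  sumOver-two-points (x∉xs ∷ xs!) (there k∈xs) (there l∈xs) k≢l f≡0 =
    ≡.cong₂ _+_ (f≡0 (here ≡.refl) (All.lookup x∉xs k∈xs) (All.lookup x∉xs l∈xs))
                (sumOver-two-points xs! k∈xs l∈xs k≢l (f≡0 ∘ there))

  2≤length : ∀ {x y} {ys : List A} → x ∈ ys → y ∈ ys → x ≢ y → 2 ≤ length ys
  2≤length (here ≡.refl) (here ≡.refl) x≢y = contradiction ≡.refl x≢y
  2≤length (here ≡.refl) (there y∈ys) _ = s≤s (∈-length y∈ys)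
  2≤length (there x∈ys) (here ≡.refl) _ = s≤s (∈-length x∈ys)
  2≤length (there x∈ys) (there y∈ys) x≢y = ℕ.m≤n⇒m≤1+n (2≤length x∈ys y∈ys x≢y)

module _ {a b} {A : Set a} {B : Set b} where
  open import Data.Nat using (_+_; _*_)

  sumOver-map : ∀ (h : A → B) xs (f : B → ℕ) → sumOver (map h xs) f ≡ sumOver xs (f ∘ h)
  sumOver-map h xs f = ≡.cong sum (≡.sym (List.map-∘ xs))

  sumOver-concatMap : ∀ (g : A → List B) xs (f : B → ℕ) →
                      sumOver (concatMap g xs) f ≡ sumOver xs (λ x → sumOver (g x) f)
  sumOver-concatMap g [] f = ≡.refl
  sumOver-concatMap g (x ∷ xs) f =
    ≡.trans (≡.cong sum (List.map-++ f (g x) (concatMap g xs)))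
    (≡.trans (sum-++ (map f (g x)) (map f (concatMap g xs)))
             (≡.cong (sumOver (g x) f +_) (sumOver-concatMap g xs f)))

  length-filterᵇ-map : ∀ (p : B → Bool) (h : A → B) xs → length (filterᵇ p (map h xs)) ≡ length (filterᵇ (p ∘ h) xs)
  length-filterᵇ-map p h xs =
    ≡.trans (length-filterᵇ p (map h xs))
    (≡.trans (sumOver-map h xs (indicator ∘ p)) (≡.sym (length-filterᵇ (p ∘ h) xs)))

  length-cartesianProduct : ∀ (xs : List A) (ys : List B) → length (cartesianProduct xs ys) ≡ length xs * length ys
  length-cartesianProduct [] ys = ≡.refl
  length-cartesianProduct (x ∷ xs) ys =
    ≡.trans (List.length-++ (map (x ,_) ys))
            (≡.cong₂ _+_ (List.length-map (x ,_) ys) (length-cartesianProduct xs ys))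

module _ {a} {A : Set a} {p : A → Bool} where

  length-filterᵇ-accept : ∀ {x} xs → T (p x) → length (filterᵇ p (x ∷ xs)) ≡ suc (length (filterᵇ p xs))
  length-filterᵇ-accept xs px = ≡.cong length (List.filter-accept (T? ∘ p) px)

  length-filterᵇ-reject : ∀ {x} xs → ¬ T (p x) → length (filterᵇ p (x ∷ xs)) ≡ length (filterᵇ p xs)
  length-filterᵇ-reject xs ¬px = ≡.cong length (List.filter-reject (T? ∘ p) ¬px)

  length-filterᵇ-none : ∀ xs → (∀ x → ¬ T (p x)) → length (filterᵇ p xs) ≡ 0
  length-filterᵇ-none xs ¬p = ≡.cong length (List.filter-none (T? ∘ p) (All.universal ¬p xs))

module _ {a} {A : Set a} (_≟_ : DecidableEquality A) where
  open import Data.Nat using (_+_)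
  open import Data.List.Membership.DecPropositional _≟_ using (_∈?_; _∉?_)

  length-filter-∁ : ∀ {p} {P : Pred A p} (P? : Decidable P) xs →
                    length (filter P? xs) + length (filter (∁? P?) xs) ≡ length xs
  length-filter-∁ P? [] = ≡.refl
  length-filter-∁ P? (x ∷ xs) with P? x
  ... | yes _ = ≡.cong suc (length-filter-∁ P? xs)
  ... | no _ = ≡.trans (ℕ.+-suc _ _) (≡.cong suc (length-filter-∁ P? xs))

  length-filter-∈ : ∀ {xs ys} → Unique xs → Unique ys → ys ⊆ xs → length (filter (_∈? ys) xs) ≡ length ys
  length-filter-∈ {xs} {ys} xs! ys! ys⊆xs =
    ↭-length (∼bag⇒↭ (unique∧set⇒bag (Unique.filter⁺ (_∈? ys) xs!) ys!
      (mk⇔ (proj₂ ∘ ∈-filter⁻ (_∈? ys) {xs = xs}) (λ y∈ys → ∈-filter⁺ (_∈? ys) (ys⊆xs y∈ys) y∈ys))))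

  length-punctured : ∀ {xs o} → Unique xs → o ∈ xs → length xs ≡ suc (length (filter (_∉? [ o ]) xs))
  length-punctured {xs} {o} xs! o∈xs =
    ≡.trans (≡.sym (length-filter-∁ (_∈? [ o ]) xs))
            (≡.cong (_+ length (filter (_∉? [ o ]) xs)) (length-filter-∈ xs! ([] ∷ []) λ { (here ≡.refl) → o∈xs }))

  module OrbitCounting {p} (P : Pred A p) (k : ℕ) (orbit : A → List A)
    (orbit-unique : ∀ {x} → P x → Unique (orbit x))
    (orbit-length : ∀ x → length (orbit x) ≡ k)
    (orbit-refl : ∀ x → x ∈ orbit x)
    (orbit-sym : ∀ {x y} → y ∈ orbit x → x ∈ orbit y)
    (orbit-trans : ∀ {x y z} → y ∈ orbit x → z ∈ orbit y → z ∈ orbit x) where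

    OrbitClosed : List A → Set a
    OrbitClosed xs = ∀ {x} → x ∈ xs → orbit x ⊆ xs

    private
      orbits-divide : ∀ n xs → length xs ≤ n → Unique xs → All P xs → OrbitClosed xs → k ∣ length xs
      orbits-divide _ [] _ _ _ _ = k ∣0
      orbits-divide (suc n) xs@(x ∷ _) (s≤s |xs|≤n) xs! Pxs closed =
        ≡.subst (k ∣_) split (∣m∣n⇒∣m+n ∣-refl (orbits-divide n rest |rest|≤n rest! Prest rest-closed))
        where
        rest = filter (_∉? orbit x) xs
        split : k + length rest ≡ length xs
        split = ≡.trans (≡.cong (_+ length rest) (≡.trans (≡.sym (orbit-length x))
                           (≡.sym (length-filter-∈ xs! (orbit-unique (All.lookup Pxs (here ≡.refl))) (closed (here ≡.refl))))))
                        (length-filter-∁ (_∈? orbit x) xs)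
        |rest|≤n : length rest ≤ n
        |rest|≤n = ℕ.+-cancelˡ-≤ 1 _ _
          (ℕ.≤-trans (ℕ.+-monoˡ-≤ (length rest) 1≤k) (ℕ.≤-trans (ℕ.≤-reflexive split) (s≤s |xs|≤n)))
          where
          1≤k : 1 ≤ k
          1≤k = ≡.subst (1 ≤_) (orbit-length x) (∈-length (orbit-refl x))
        rest! : Unique rest
        rest! = Unique.filter⁺ (_∉? orbit x) xs!
        Prest : All P rest
        Prest = All.tabulate (All.lookup Pxs ∘ proj₁ ∘ ∈-filter⁻ (_∉? orbit x) {xs = xs})
        rest-closed : OrbitClosed rest
        rest-closed y∈rest z∈orbit-y with ∈-filter⁻ (_∉? orbit x) y∈rest
        ... | y∈xs , y∉orbit-x = ∈-filter⁺ (_∉? orbit x) (closed y∈xs z∈orbit-y)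
                                   (λ z∈orbit-x → y∉orbit-x (orbit-trans z∈orbit-x (orbit-sym z∈orbit-y)))

    k∣length : ∀ {xs} → Unique xs → All P xs → OrbitClosed xs → k ∣ length xs
    k∣length {xs} = orbits-divide (length xs) xs ℕ.≤-refl

    k∣length-punctured : ∀ {xs o} → Unique xs → (∀ x → x ∈ xs) → (∀ {x} → x ≢ o → P x) →
                         (∀ {x y} → x ≢ o → y ∈ orbit x → y ≢ o) → k ∣ length (filter (_∉? [ o ]) xs)
    k∣length-punctured {xs} {o} xs! complete P-off-o orbit-off-o =
      k∣length (Unique.filter⁺ (_∉? [ o ]) xs!) (All.tabulate (P-off-o ∘ ≢o)) closed
      where
      ≢o : ∀ {x} → x ∈ filter (_∉? [ o ]) xs → x ≢ o
      ≢o x∈ x≡o = proj₂ (∈-filter⁻ (_∉? [ o ]) {xs = xs} x∈) (here x≡o)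
      closed : OrbitClosed (filter (_∉? [ o ]) xs)
      closed x∈ y∈orbit = ∈-filter⁺ (_∉? [ o ]) (complete _) λ { (here y≡o) → orbit-off-o (≢o x∈) y∈orbit y≡o }

module Involution {a} {A : Set a} (σ : A → A) (σ-involutive : ∀ x → σ (σ x) ≡ x) where

  orbit : A → List A
  orbit x = x ∷ σ x ∷ []

  orbit-refl : ∀ x → x ∈ orbit x
  orbit-refl x = here ≡.refl

  orbit-sym : ∀ {x y} → y ∈ orbit x → x ∈ orbit y
  orbit-sym (here ≡.refl) = here ≡.refl
  orbit-sym {x} (there (here ≡.refl)) = there (here (≡.sym (σ-involutive x)))

  orbit-trans : ∀ {x y z} → y ∈ orbit x → z ∈ orbit y → z ∈ orbit x
  orbit-trans (here ≡.refl) z∈orbit-y = z∈orbit-y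
  orbit-trans (there (here ≡.refl)) (here ≡.refl) = there (here ≡.refl)
  orbit-trans {x} (there (here ≡.refl)) (there (here ≡.refl)) = here (σ-involutive x)

  orbit-unique : ∀ {x} → σ x ≢ x → Unique (orbit x)
  orbit-unique σx≢x = (≡.≢-sym σx≢x ∷ []) ∷ [] ∷ []

  orbit-avoids : ∀ {o x y} → σ o ≡ o → x ≢ o → y ∈ orbit x → y ≢ o
  orbit-avoids _ x≢o (here ≡.refl) = x≢o
  orbit-avoids {o} {x} σo≡o x≢o (there (here ≡.refl)) σx≡o =
    x≢o (≡.trans (≡.sym (σ-involutive x)) (≡.trans (≡.cong σ σx≡o) σo≡o))

module Period₃ {a} {A : Set a} (σ : A → A) (σ³≡id : ∀ x → σ (σ (σ x)) ≡ x) where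

  orbit : A → List A
  orbit x = x ∷ σ x ∷ σ (σ x) ∷ []

  orbit-refl : ∀ x → x ∈ orbit x
  orbit-refl x = here ≡.refl

  orbit-sym : ∀ {x y} → y ∈ orbit x → x ∈ orbit y
  orbit-sym (here ≡.refl) = here ≡.refl
  orbit-sym {x} (there (here ≡.refl)) = there (there (here (≡.sym (σ³≡id x))))
  orbit-sym {x} (there (there (here ≡.refl))) = there (here (≡.sym (σ³≡id x)))

  orbit-trans : ∀ {x y z} → y ∈ orbit x → z ∈ orbit y → z ∈ orbit x
  orbit-trans (here ≡.refl) z∈orbit-y = z∈orbit-y
  orbit-trans (there (here ≡.refl)) (here ≡.refl) = there (here ≡.refl)
  orbit-trans (there (here ≡.refl)) (there (here ≡.refl)) = there (there (here ≡.refl))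
  orbit-trans {x} (there (here ≡.refl)) (there (there (here ≡.refl))) = here (σ³≡id x)
  orbit-trans (there (there (here ≡.refl))) (here ≡.refl) = there (there (here ≡.refl))
  orbit-trans {x} (there (there (here ≡.refl))) (there (here ≡.refl)) = here (σ³≡id x)
  orbit-trans {x} (there (there (here ≡.refl))) (there (there (here ≡.refl))) = there (here (≡.cong σ (σ³≡id x)))

  orbit-unique : ∀ {x} → σ x ≢ x → Unique (orbit x)
  orbit-unique {x} σx≢x = (≡.≢-sym σx≢x ∷ x≢σ²x ∷ []) ∷ (σx≢σ²x ∷ []) ∷ [] ∷ []
    where
    x≢σ²x : x ≢ σ (σ x)
    x≢σ²x x≡σ²x = σx≢x (≡.trans (≡.cong σ x≡σ²x) (σ³≡id x))
    σx≢σ²x : σ x ≢ σ (σ x)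
    σx≢σ²x σx≡σ²x = σx≢x (≡.trans σx≡σ²x (≡.trans (≡.cong σ σx≡σ²x) (σ³≡id x)))

  σ-preserves-≢ : ∀ {o x} → σ o ≡ o → x ≢ o → σ x ≢ o
  σ-preserves-≢ {o} {x} σo≡o x≢o σx≡o =
    x≢o (≡.trans (≡.sym (σ³≡id x)) (≡.trans (≡.cong (σ ∘ σ) σx≡o) (≡.trans (≡.cong σ σo≡o) σo≡o)))

  orbit-avoids : ∀ {o x y} → σ o ≡ o → x ≢ o → y ∈ orbit x → y ≢ o
  orbit-avoids _ x≢o (here ≡.refl) = x≢o
  orbit-avoids σo≡o x≢o (there (here ≡.refl)) = σ-preserves-≢ σo≡o x≢o
  orbit-avoids σo≡o x≢o (there (there (here ≡.refl))) = σ-preserves-≢ σo≡o (σ-preserves-≢ σo≡o x≢o)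

module FiniteFieldArithmetic (F : FiniteField) where
  open FiniteField F
  open import Data.Nat using () renaming (_+_ to _+ℕ_; _*_ to _*ℕ_)

  commutativeRing : CommutativeRing _ _
  commutativeRing = record { isCommutativeRing = isCommutativeRing }

  open CommutativeRing commutativeRing public using (+-identityʳ; *-identityˡ; *-identityʳ; zeroʳ; -‿inverseʳ; ring)
  open import Algebra.Properties.Ring ring public using (-0#≈0#; -‿involutive; -‿injective; +-inverseˡ-unique; +-inverseʳ-unique)
  open IntegerCoefficientRingSolver commutativeRing public
  open import Algebra.Properties.Semiring.Mult (CommutativeRing.semiring commutativeRing) using (×-homo-+; ×1-homo-*)
  open ≡.≡-Reasoning
  open import Data.List.Membership.DecPropositional _≟_ using (_∉?_)

  :fromℕ : ∀ {n} → ℕ → Polynomial n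
  :fromℕ zero = :0
  :fromℕ (suc k) = :1 :+ :fromℕ k

  nonzero*y≡0⇒y≡0 : ∀ {x y} → x ≢ 0# → x * y ≡ 0# → y ≡ 0#
  nonzero*y≡0⇒y≡0 {x} {y} x≢0 xy≡0 with inverse x x≢0
  ... | x⁻¹ , xx⁻¹≡1 = begin
    y                  ≡⟨ solve 1 (λ y → y := :1 :* y) ≡.refl y ⟩
    1# * y             ≡⟨ ≡.cong (_* y) xx⁻¹≡1 ⟨
    (x * x⁻¹) * y      ≡⟨ solve 3 (λ x x⁻¹ y → (x :* x⁻¹) :* y := x⁻¹ :* (x :* y)) ≡.refl x x⁻¹ y ⟩
    x⁻¹ * (x * y)      ≡⟨ ≡.cong (x⁻¹ *_) xy≡0 ⟩
    x⁻¹ * 0#           ≡⟨ zeroʳ x⁻¹ ⟩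
    0#                 ∎

  order-odd : fromℕ F 2 ≢ 0# → ¬ 2 ∣ order F
  order-odd 2≢0 2∣q = contradiction (∣1⇒≡1 (∣m+n∣m⇒∣n 2∣m+1 2∣m)) λ ()
    where
    -x≢x : ∀ {x} → x ≢ 0# → - x ≢ x
    -x≢x {x} x≢0 -x≡x = x≢0 (nonzero*y≡0⇒y≡0 2≢0 (begin
      fromℕ F 2 * x   ≡⟨ solve 1 (λ x → :fromℕ 2 :* x := x :+ x) ≡.refl x ⟩
      x + x           ≡⟨ ≡.cong (x +_) -x≡x ⟨
      x + - x         ≡⟨ -‿inverseʳ x ⟩
      0#              ∎))
    open Involution -_ -‿involutive
    open OrbitCounting _≟_ (_≢ 0#) 2 orbit (orbit-unique ∘ -x≢x) (λ _ → ≡.refl) orbit-refl orbit-sym orbit-trans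
    m = length (filter (_∉? [ 0# ]) elements)
    2∣m : 2 ∣ m
    2∣m = k∣length-punctured unique complete (λ x≢0 → x≢0) (orbit-avoids -0#≈0#)
    2∣m+1 : 2 ∣ m +ℕ 1
    2∣m+1 = ≡.subst (2 ∣_) (≡.trans (length-punctured _≟_ unique (complete 0#)) (ℕ.+-comm 1 m)) 2∣q

  order-indivisible-by-3 : fromℕ F 3 ≢ 0# → ¬ 3 ∣ order F
  order-indivisible-by-3 3≢0 3∣q = contradiction (∣1⇒≡1 (∣m+n∣m⇒∣n 3∣m+1 3∣m)) λ ()
    where
    open import Data.Product.Properties using (≡-dec)
    _≟²_ : DecidableEquality (Carrier × Carrier)
    _≟²_ = ≡-dec _≟_ _≟_
    open import Data.List.Membership.DecPropositional _≟²_ using () renaming (_∉?_ to _∉²?_)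
    rotate : Carrier × Carrier → Carrier × Carrier
    rotate (x , y) = y , - (x + y)
    rotate³≡id : ∀ v → rotate (rotate (rotate v)) ≡ v
    rotate³≡id (x , y) = ≡.cong₂ _,_
      (solve 2 (λ x y → :- (y :+ :- (x :+ y)) := x) ≡.refl x y)
      (solve 2 (λ x y → :- (:- (x :+ y) :+ :- (y :+ :- (x :+ y))) := y) ≡.refl x y)
    rotate-fixes-origin : rotate (0# , 0#) ≡ (0# , 0#)
    rotate-fixes-origin = ≡.cong (0# ,_) (≡.trans (≡.cong -_ (+-identityʳ 0#)) -0#≈0#)
    rotate-free : ∀ {v} → v ≢ (0# , 0#) → rotate v ≢ v
    rotate-free {x , y} v≢0 rv≡v with ≡.cong proj₁ rv≡v | ≡.cong proj₂ rv≡v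
    ... | ≡.refl | -2x≡x = v≢0 (≡.cong₂ _,_ x≡0 x≡0)
      where
      x≡0 : x ≡ 0#
      x≡0 = nonzero*y≡0⇒y≡0 3≢0 (begin
        fromℕ F 3 * x     ≡⟨ solve 1 (λ x → :fromℕ 3 :* x := (x :+ x) :+ x) ≡.refl x ⟩
        (x + x) + x       ≡⟨ ≡.cong ((x + x) +_) -2x≡x ⟨
        (x + x) + - (x + x) ≡⟨ -‿inverseʳ (x + x) ⟩
        0#                ∎)
    pairs : List (Carrier × Carrier)
    pairs = cartesianProduct elements elements
    open Period₃ rotate rotate³≡id
    open OrbitCounting _≟²_ (_≢ (0# , 0#)) 3 orbit (orbit-unique ∘ rotate-free) (λ _ → ≡.refl) orbit-refl orbit-sym orbit-trans
    pairs! : Unique pairs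
    pairs! = Unique.cartesianProduct⁺ unique unique
    pairs-complete : ∀ v → v ∈ pairs
    pairs-complete (x , y) = ∈-cartesianProduct⁺ (complete x) (complete y)
    m = length (filter (_∉²? [ (0# , 0#) ]) pairs)
    3∣m : 3 ∣ m
    3∣m = k∣length-punctured pairs! pairs-complete (λ v≢0 → v≢0) (orbit-avoids rotate-fixes-origin)
    3∣m+1 : 3 ∣ m +ℕ 1
    3∣m+1 = ≡.subst (3 ∣_) (≡.trans (≡.sym (length-cartesianProduct elements elements))
                          (≡.trans (length-punctured _≟²_ pairs! (pairs-complete _)) (ℕ.+-comm 1 m)))
                   (∣m⇒∣m*n (order F) 3∣q)

  9≡3*3 : fromℕ F 9 ≡ fromℕ F 3 * fromℕ F 3
  9≡3*3 = ×1-homo-* 3 3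

  9≡1+2*4 : fromℕ F 9 ≡ fromℕ F 1 + fromℕ F 2 * fromℕ F 4
  9≡1+2*4 = ≡.trans (×-homo-+ 1# 1 8) (≡.cong (fromℕ F 1 +_) (×1-homo-* 2 4))

  9*μ≢1 : ∀ {μ} → μ ≢ 1# → (¬ (order F % 2 ≡ 0) → ¬ (order F % 3 ≡ 0) → fromℕ F 9 * μ ≢ 1#) →
          fromℕ F 9 * μ ≢ 1#
  9*μ≢1 {μ} μ≢1 _ 9μ≡1 with fromℕ F 2 ≟ 0#
  ... | yes 2≡0 = μ≢1 (begin
    μ                                  ≡⟨ solve 2 (λ μ four → μ := (:fromℕ 1 :+ :0 :* four) :* μ) ≡.refl μ (fromℕ F 4) ⟩
    (fromℕ F 1 + 0# * fromℕ F 4) * μ   ≡⟨ ≡.cong (λ two → (fromℕ F 1 + two * fromℕ F 4) * μ) 2≡0 ⟨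
    (fromℕ F 1 + fromℕ F 2 * fromℕ F 4) * μ ≡⟨ ≡.cong (_* μ) 9≡1+2*4 ⟨
    fromℕ F 9 * μ                      ≡⟨ 9μ≡1 ⟩
    1#                                 ∎)
  9*μ≢1 {μ} μ≢1 excluded 9μ≡1 | no 2≢0 with fromℕ F 3 ≟ 0#
  ... | yes 3≡0 = 0≢1 (begin
    0#                                 ≡⟨ solve 1 (λ μ → :0 := :0 :* :0 :* μ) ≡.refl μ ⟩
    0# * 0# * μ                        ≡⟨ ≡.cong (λ three → three * three * μ) 3≡0 ⟨
    fromℕ F 3 * fromℕ F 3 * μ          ≡⟨ ≡.cong (_* μ) 9≡3*3 ⟨
    fromℕ F 9 * μ                      ≡⟨ 9μ≡1 ⟩
    1#                                 ∎)
  ... | no 3≢0 = excluded (order-odd 2≢0 ∘ m%n≡0⇒n∣m _ 2) (order-indivisible-by-3 3≢0 ∘ m%n≡0⇒n∣m _ 3) 9μ≡1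

  osculation-forces-9*μ≡1 : ∀ μ t → fromℕ F 3 * t * t ≡ - 1# → μ * - (fromℕ F 3 * t) ≡ t * t * t →
                            fromℕ F 9 * μ ≡ 1#
  osculation-forces-9*μ≡1 μ t 3t²≡-1 μb≡t³ = begin
    fromℕ F 9 * μ                      ≡⟨ ≡.cong (_* μ) 9≡3*3 ⟩
    s * s * μ                          ≡⟨ solve 2 (λ s μ → s :* s :* μ := s :* s :* μ :* :- (:- :1)) ≡.refl s μ ⟩
    s * s * μ * - (- 1#)               ≡⟨ ≡.cong (λ z → s * s * μ * - z) 3t²≡-1 ⟨
    s * s * μ * - (s * t * t)          ≡⟨ solve 3 (λ s μ t → s :* s :* μ :* :- (s :* t :* t) := s :* s :* t :* (μ :* :- (s :* t))) ≡.refl s μ t ⟩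
    s * s * t * (μ * - (s * t))        ≡⟨ ≡.cong (s * s * t *_) μb≡t³ ⟩
    s * s * t * (t * t * t)            ≡⟨ solve 2 (λ s t → s :* s :* t :* (t :* t :* t) := (s :* t :* t) :* (s :* t :* t)) ≡.refl s t ⟩
    (s * t * t) * (s * t * t)          ≡⟨ ≡.cong₂ _*_ 3t²≡-1 3t²≡-1 ⟩
    - 1# * - 1#                        ≡⟨ solve 0 (:- :1 :* :- :1 := :1) ≡.refl ⟩
    1#                                 ∎
    where
    s = fromℕ F 3

module ProjectiveSpace (F : FiniteField) where
  open FiniteField F
  open FiniteFieldArithmetic F
  open ≡.≡-Reasoning

  1≢0 : 1# ≢ 0#
  1≢0 = 0≢1 ∘ ≡.sym

  ==-sound : ∀ {x y} → T (_==_ F x y) → x ≡ y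
  ==-sound {x} {y} with x ≟ y
  ... | yes x≡y = λ _ → x≡y
  ... | no _ = λ ()

  ==-complete : ∀ {x y} → x ≡ y → T (_==_ F x y)
  ==-complete {x} {y} x≡y with x ≟ y
  ... | yes _ = _
  ... | no x≢y = x≢y x≡y

  ==-false : ∀ {x y} → T (not (_==_ F x y)) → x ≢ y
  ==-false {x} {y} with x ≟ y
  ... | yes _ = λ ()
  ... | no x≢y = λ _ → x≢y

  v4-cong : ∀ {a b c d a′ b′ c′ d′} → a ≡ a′ → b ≡ b′ → c ≡ c′ → d ≡ d′ →
            _≡_ {A = V4 F} (v4 a b c d) (v4 a′ b′ c′ d′)
  v4-cong ≡.refl ≡.refl ≡.refl ≡.refl = ≡.refl

  isZeroV-sound : ∀ {a b c d} → T (isZeroV F (v4 a b c d)) → a ≡ 0# × b ≡ 0# × c ≡ 0# × d ≡ 0#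
  isZeroV-sound {a} {b} {c} {d} abcd≡0
    with a≡0 , bcd≡0 ← T-∧⁻ {_==_ F a 0#} abcd≡0
    with b≡0 , cd≡0 ← T-∧⁻ {_==_ F b 0#} bcd≡0
    with c≡0 , d≡0 ← T-∧⁻ {_==_ F c 0#} cd≡0
    = ==-sound a≡0 , ==-sound b≡0 , ==-sound c≡0 , ==-sound d≡0

  sameProj-sound : ∀ {u v} → T (sameProj F u v) → ∃ λ k → k ≢ 0# × u ≡ scale F k v
  sameProj-sound {u@(v4 u0 u1 u2 u3)} {v@(v4 v0 v1 v2 v3)} same
    with k , k≢0∧zero ← satisfied (any⁻ (λ k → not (_==_ F k 0#) ∧ isZeroV F (addV F u (scale F (- k) v))) elements same)
    with k≢0 , u-kv≡0 ← T-∧⁻ {not (_==_ F k 0#)} k≢0∧zero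
    with e0 , e1 , e2 , e3 ← isZeroV-sound u-kv≡0
    = k , ==-false k≢0 , v4-cong (multiple e0) (multiple e1) (multiple e2) (multiple e3)
    where
    multiple : ∀ {x y} → x + (- k) * y ≡ 0# → x ≡ k * y
    multiple {x} {y} x-ky≡0 = ≡.trans (+-inverseˡ-unique x ((- k) * y) x-ky≡0)
                                      (solve 2 (λ k y → :- (:- k :* y) := k :* y) ≡.refl k y)

  osculatingPlaneAt : Carrier → V4 F
  osculatingPlaneAt t = v4 1# (- (fromℕ F 3 * t)) (fromℕ F 3 * t * t) (- (t * t * t))

  not-osculating : ∀ {π} → (∀ {k} → k ≢ 0# → π ≢ scale F k (v4 0# 0# 0# 1#)) →
                   (∀ {k} t → k ≢ 0# → π ≢ scale F k (osculatingPlaneAt t)) → isOsculating F π ≡ false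
  not-osculating {π} not-∞ not-finite = ¬T⇒≡false λ osc → case any⁻ (sameProj F π) (osculatingPlanes F) osc of λ where
      (here same) → let k , k≢0 , eq = sameProj-sound same in not-∞ k≢0 eq
      (there same-finite) → let t , same = satisfied (map⁻ same-finite)
                                k , k≢0 , eq = sameProj-sound same
                            in not-finite t k≢0 eq

  ∑ : (Carrier → ℕ) → ℕ
  ∑ = sumOver elements

  ∑-point : ∀ {f} k → (∀ x → x ≢ k → f x ≡ 0) → ∑ f ≡ f k
  ∑-point k f≡0 = sumOver-point unique (complete k) λ {x} _ → f≡0 x

  ∑-allV4 : ∀ (f : V4 F → ℕ) → sumOver (allV4 F) f ≡ ∑ λ a → ∑ λ b → ∑ λ c → ∑ λ d → f (v4 a b c d)
  ∑-allV4 f =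
    ≡.trans (sumOver-concatMap _ elements f) (sumOver-cong elements λ a →
    ≡.trans (sumOver-concatMap _ elements f) (sumOver-cong elements λ b →
    ≡.trans (sumOver-concatMap _ elements f) (sumOver-cong elements λ c →
    sumOver-map (v4 a b c) elements f)))

module PencilThroughℓμ (F : FiniteField) (μ : FiniteField.Carrier F) where
  open FiniteField F
  open FiniteFieldArithmetic F
  open ProjectiveSpace F
  open ≡.≡-Reasoning

  planeThrough : Carrier → Carrier → V4 F
  planeThrough a b = v4 a b (- a) (- (μ * b))

  π∞ : V4 F
  π∞ = planeThrough 0# 1#

  incidence-on-ℓ : ∀ c0 c1 c2 c3 s t →
    onPlane F (v4 c0 c1 c2 c3) (addV F (scale F s (Pμ F μ)) (scale F t (P1010 F)))
      ≡ _==_ F (t * (c0 + c2) + s * (μ * c1 + c3)) 0#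
  incidence-on-ℓ c0 c1 c2 c3 s t = ≡.cong (λ e → _==_ F e 0#)
    (solve 7 (λ c0 c1 c2 c3 μ s t →
                c0 :* (s :* :0 :+ t :* :1) :+ c1 :* (s :* μ :+ t :* :0) :+ c2 :* (s :* :0 :+ t :* :1) :+ c3 :* (s :* :1 :+ t :* :0)
                := t :* (c0 :+ c2) :+ s :* (μ :* c1 :+ c3))
           ≡.refl c0 c1 c2 c3 μ s t)

  containsLine-sound : ∀ {c0 c1 c2 c3} → T (containsLine F (v4 c0 c1 c2 c3) (Pμ F μ) (P1010 F)) →
                       c2 ≡ - c0 × c3 ≡ - (μ * c1)
  containsLine-sound {c0} {c1} {c2} {c3} ℓ⊆π =
      +-inverseʳ-unique c0 c2
        (≡.trans (solve 5 (λ c0 c1 c2 c3 μ → c0 :+ c2 := :1 :* (c0 :+ c2) :+ :0 :* (μ :* c1 :+ c3)) ≡.refl c0 c1 c2 c3 μ)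
                 (on 0# 1#))
    , +-inverseʳ-unique (μ * c1) c3
        (≡.trans (solve 5 (λ c0 c1 c2 c3 μ → μ :* c1 :+ c3 := :0 :* (c0 :+ c2) :+ :1 :* (μ :* c1 :+ c3)) ≡.refl c0 c1 c2 c3 μ)
                 (on 1# 0#))
    where
    on : ∀ s t → t * (c0 + c2) + s * (μ * c1 + c3) ≡ 0#
    on s t = ==-sound (≡.subst T (incidence-on-ℓ c0 c1 c2 c3 s t) (T-all (T-all ℓ⊆π (complete s)) (complete t)))

  containsLine-pencil : ∀ a b → T (containsLine F (planeThrough a b) (Pμ F μ) (P1010 F))
  containsLine-pencil a b = all⁻ _ (All.universal (λ s → all⁻ _ (All.universal (λ t →
    ≡.subst T (≡.sym (incidence-on-ℓ a b (- a) (- (μ * b)) s t))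
      (==-complete (solve 5 (λ μ a b s t → t :* (a :+ :- a) :+ s :* (μ :* b :+ :- (μ :* b)) := :0) ≡.refl μ a b s t)))
    elements)) elements)

  normalised-pencil : ∀ {a b} → T (isNormalised F (planeThrough a b)) → a ≡ 1# ⊎ (a ≡ 0# × b ≡ 1#)
  normalised-pencil {a} {b} normalised with a ≟ 0#
  ... | no _ = inj₁ (==-sound normalised)
  ... | yes a≡0 with b ≟ 0#
  ...   | no _ = inj₂ (a≡0 , ==-sound normalised)
  ...   | yes b≡0 with (- a) ≟ 0#
  ...     | no -a≢0 = contradiction (≡.trans (≡.cong -_ a≡0) -0#≈0#) -a≢0
  ...     | yes _ = contradiction (begin
    0#            ≡⟨ solve 1 (λ μ → :0 := :- (μ :* :0)) ≡.refl μ ⟩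
    - (μ * 0#)    ≡⟨ ≡.cong (λ b → - (μ * b)) b≡0 ⟨
    - (μ * b)     ≡⟨ ==-sound normalised ⟩
    1#            ∎) 0≢1

  normalised-leading-1 : ∀ {b c d} → T (isNormalised F (v4 1# b c d))
  normalised-leading-1 rewrite dec-false (1# ≟ 0#) 1≢0 | dec-true (1# ≟ 1#) ≡.refl = _

  normalised-π∞ : T (isNormalised F π∞)
  normalised-π∞ rewrite dec-true (0# ≟ 0#) ≡.refl | dec-false (1# ≟ 0#) 1≢0 | dec-true (1# ≟ 1#) ≡.refl = _

  pencil-not-osculating : fromℕ F 9 * μ ≢ 1# → ∀ b → isOsculating F (planeThrough 1# b) ≡ false
  pencil-not-osculating 9μ≢1 b = not-osculating
    (λ {k} _ π≡k∞ → 1≢0 (≡.trans (≡.cong V4.c0 π≡k∞) (zeroʳ k)))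
    λ {k} t _ π≡kπₜ →
      let k·x≡x : ∀ x → k * x ≡ x
          k·x≡x x = ≡.trans (≡.cong (_* x) (≡.trans (≡.sym (*-identityʳ k)) (≡.sym (≡.cong V4.c0 π≡kπₜ)))) (*-identityˡ x)
          3t²≡-1 = ≡.sym (≡.trans (≡.cong V4.c2 π≡kπₜ) (k·x≡x _))
          b≡-3t = ≡.trans (≡.cong V4.c1 π≡kπₜ) (k·x≡x _)
          μb≡t³ = -‿injective (≡.trans (≡.cong V4.c3 π≡kπₜ) (k·x≡x _))
      in 9μ≢1 (osculation-forces-9*μ≡1 μ t 3t²≡-1 (≡.trans (≡.cong (μ *_) (≡.sym b≡-3t)) μb≡t³))

  π∞-not-osculating : isOsculating F π∞ ≡ false
  π∞-not-osculating = not-osculating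
    (λ {k} _ π≡k∞ → 1≢0 (≡.trans (≡.cong V4.c1 π≡k∞) (zeroʳ k)))
    (λ {k} _ k≢0 π≡kπₜ → k≢0 (≡.trans (≡.sym (*-identityʳ k)) (≡.sym (≡.cong V4.c0 π≡kπₜ))))

  cubicPoint : Carrier → V4 F
  cubicPoint t = v4 (t * t * t) (t * t) t 1#

  pencil-meets-cubicPoint : ∀ b t →
    onPlane F (planeThrough 1# b) (cubicPoint t) ≡ _==_ F (((t * t * t + b * t * t) + - t) + - (μ * b)) 0#
  pencil-meets-cubicPoint b t = ≡.cong (λ e → _==_ F e 0#)
    (solve 3 (λ μ b t → :1 :* (t :* t :* t) :+ b :* (t :* t) :+ :- :1 :* t :+ :- (μ :* b) :* :1
                        := ((t :* t :* t :+ b :* t :* t) :+ :- t) :+ :- (μ :* b))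
           ≡.refl μ b t)

  π∞-meets-cubicPoint : ∀ t → onPlane F π∞ (cubicPoint t) ≡ _==_ F (t * t + - μ) 0#
  π∞-meets-cubicPoint t = ≡.cong (λ e → _==_ F e 0#)
    (solve 2 (λ μ t → :0 :* (t :* t :* t) :+ :1 :* (t :* t) :+ :- :0 :* t :+ :- (μ :* :1) :* :1 := t :* t :+ :- μ)
           ≡.refl μ t)

  π∞-meets-P∞ : T (onPlane F π∞ (v4 1# 0# 0# 0#))
  π∞-meets-P∞ = ==-complete (solve 1 (λ μ → :0 :* :1 :+ :1 :* :0 :+ :- :0 :* :0 :+ :- (μ :* :1) :* :0 := :0) ≡.refl μ)

  pointsOfC-pencil : ∀ b → pointsOfC F (planeThrough 1# b) ≡ numRoots F μ b
  pointsOfC-pencil b = begin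
    pointsOfC F π
      ≡⟨ length-filterᵇ-reject {p = onPlane F π} (map cubicPoint elements) P∞∉π ⟩
    length (filterᵇ (onPlane F π) (map cubicPoint elements))
      ≡⟨ length-filterᵇ-map (onPlane F π) cubicPoint elements ⟩
    length (filterᵇ (onPlane F π ∘ cubicPoint) elements)
      ≡⟨ length-filterᵇ-cong elements (pencil-meets-cubicPoint b) ⟩
    numRoots F μ b
      ∎
    where
    π = planeThrough 1# b
    P∞∉π : ¬ T (onPlane F π (v4 1# 0# 0# 0#))
    P∞∉π P∞∈π = 1≢0 (≡.trans
      (solve 2 (λ μ b → :1 := :1 :* :1 :+ b :* :0 :+ :- :1 :* :0 :+ :- (μ :* b) :* :0) ≡.refl μ b)
      (==-sound P∞∈π))

  pointsOfC-π∞-square : IsSquare F μ → 2 ≤ pointsOfC F π∞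
  pointsOfC-π∞-square (x , x²≡μ) = 2≤length P∞∈ Pₓ∈ λ P∞≡Pₓ → 0≢1 (≡.cong V4.c3 P∞≡Pₓ)
    where
    P∞∈ : v4 1# 0# 0# 0# ∈ filterᵇ (onPlane F π∞) (cubicPoints F)
    P∞∈ = ∈-filter⁺ (T? ∘ onPlane F π∞) (here ≡.refl) π∞-meets-P∞
    Pₓ∈ : cubicPoint x ∈ filterᵇ (onPlane F π∞) (cubicPoints F)
    Pₓ∈ = ∈-filter⁺ (T? ∘ onPlane F π∞) (there (∈-map⁺ cubicPoint (complete x)))
      (≡.subst T (≡.sym (π∞-meets-cubicPoint x))
        (==-complete (≡.trans (≡.cong (_+ - μ) x²≡μ) (-‿inverseʳ μ))))

  pointsOfC-π∞-nonsquare : ¬ IsSquare F μ → pointsOfC F π∞ ≡ 1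
  pointsOfC-π∞-nonsquare nonsquare =
    ≡.trans (length-filterᵇ-accept {p = onPlane F π∞} (map cubicPoint elements) π∞-meets-P∞) (≡.cong suc (begin
    length (filterᵇ (onPlane F π∞) (map cubicPoint elements)) ≡⟨ length-filterᵇ-map (onPlane F π∞) cubicPoint elements ⟩
    length (filterᵇ (onPlane F π∞ ∘ cubicPoint) elements)    ≡⟨ length-filterᵇ-none elements no-root ⟩
    0                                                        ∎))
    where
    no-root : ∀ t → ¬ T (onPlane F π∞ (cubicPoint t))
    no-root t meets = nonsquare (t , ≡.sym (-‿injective
      (+-inverseʳ-unique (t * t) (- μ) (==-sound (≡.subst T (π∞-meets-cubicPoint t) meets)))))

  numRoots-0 : numRoots F μ 0# ≢ 1
  numRoots-0 one = contradiction (≡.subst (2 ≤_) one (2≤length (root 0# root-0) (root 1# root-1) 0≢1)) λ { (s≤s ()) }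
    where
    p : Carrier → Bool
    p t = _==_ F (((t * t * t + 0# * t * t) + - t) + - (μ * 0#)) 0#
    root : ∀ t → T (p t) → t ∈ filterᵇ p elements
    root t = ∈-filter⁺ (T? ∘ p) (complete t)
    root-0 = ==-complete (solve 1 (λ μ → ((:0 :* :0 :* :0 :+ :0 :* :0 :* :0) :+ :- :0) :+ :- (μ :* :0) := :0) ≡.refl μ)
    root-1 = ==-complete (solve 1 (λ μ → ((:1 :* :1 :* :1 :+ :0 :* :1 :* :1) :+ :- :1) :+ :- (μ :* :0) := :0) ≡.refl μ)

  pencil-oneBar : fromℕ F 9 * μ ≢ 1# → ∀ b → isOneBarPlane F (planeThrough 1# b) ≡ does (numRoots F μ b ℕ.≟ 1)
  pencil-oneBar 9μ≢1 b rewrite pencil-not-osculating 9μ≢1 b | pointsOfC-pencil b = ≡.refl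

  π∞-oneBar-square : IsSquare F μ → isOneBarPlane F π∞ ≡ false
  π∞-oneBar-square square rewrite π∞-not-osculating =
    dec-false (pointsOfC F π∞ ℕ.≟ 1) λ one → contradiction (≡.subst (2 ≤_) one (pointsOfC-π∞-square square)) λ { (s≤s ()) }

  π∞-oneBar-nonsquare : ¬ IsSquare F μ → isOneBarPlane F π∞ ≡ true
  π∞-oneBar-nonsquare nonsquare rewrite π∞-not-osculating | pointsOfC-π∞-nonsquare nonsquare = ≡.refl

  counted : V4 F → Bool
  counted π = isNormalised F π ∧ containsLine F π (Pμ F μ) (P1010 F) ∧ isOneBarPlane F π

  counted-normalised : ∀ {π} → T (counted π) → T (isNormalised F π)
  counted-normalised = proj₁ ∘ T-∧⁻

  counted-containsLine : ∀ {π} → T (counted π) → T (containsLine F π (Pμ F μ) (P1010 F))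
  counted-containsLine {π} = proj₁ ∘ T-∧⁻ {containsLine F π (Pμ F μ) (P1010 F)} ∘ proj₂ ∘ T-∧⁻ {isNormalised F π}

  counted-pencil : ∀ b → counted (planeThrough 1# b) ≡ isOneBarPlane F (planeThrough 1# b)
  counted-pencil b = ≡.trans (T⇒∧-identityˡ normalised-leading-1) (T⇒∧-identityˡ (containsLine-pencil 1# b))

  counted-π∞ : counted π∞ ≡ isOneBarPlane F π∞
  counted-π∞ = ≡.trans (T⇒∧-identityˡ normalised-π∞) (T⇒∧-identityˡ (containsLine-pencil 0# 1#))

  𝟙[_] : V4 F → ℕ
  𝟙[ π ] = indicator (counted π)

  ∑-line-condition : ∀ a b → (∑ λ c → ∑ λ d → 𝟙[ v4 a b c d ]) ≡ 𝟙[ planeThrough a b ]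
  ∑-line-condition a b =
    ≡.trans (sumOver-cong elements λ c → ∑-point (- (μ * b)) λ d d≢ →
               indicator-false (d≢ ∘ proj₂ ∘ containsLine-sound ∘ counted-containsLine))
            (∑-point (- a) λ c c≢ → indicator-false (c≢ ∘ proj₁ ∘ containsLine-sound ∘ counted-containsLine))

  count-pencil : numOneBarPlanesThrough F μ ≡ (∑ λ b → 𝟙[ planeThrough 1# b ]) ℕ.+ 𝟙[ π∞ ]
  count-pencil = begin
    numOneBarPlanesThrough F μ                               ≡⟨ length-filterᵇ counted (allV4 F) ⟩
    sumOver (allV4 F) 𝟙[_]                                   ≡⟨ ∑-allV4 𝟙[_] ⟩
    (∑ λ a → ∑ λ b → ∑ λ c → ∑ λ d → 𝟙[ v4 a b c d ])       ≡⟨ sumOver-cong elements (sumOver-cong elements ∘ ∑-line-condition) ⟩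
    (∑ λ a → ∑ λ b → 𝟙[ planeThrough a b ])                  ≡⟨ sumOver-two-points unique (complete 1#) (complete 0#) 1≢0 (λ _ → off-0-1) ⟩
    (∑ λ b → 𝟙[ planeThrough 1# b ]) ℕ.+ (∑ λ b → 𝟙[ planeThrough 0# b ])
                                                             ≡⟨ ≡.cong ((∑ λ b → 𝟙[ planeThrough 1# b ]) ℕ.+_) (∑-point 1# off-1) ⟩
    (∑ λ b → 𝟙[ planeThrough 1# b ]) ℕ.+ 𝟙[ π∞ ]             ∎
    where
    off-0-1 : ∀ {a} → a ≢ 1# → a ≢ 0# → (∑ λ b → 𝟙[ planeThrough a b ]) ≡ 0
    off-0-1 {a} a≢1 a≢0 = sumOver-zero {xs = elements} λ {b} _ → indicator-false λ c →
      [ a≢1 , a≢0 ∘ proj₁ ]′ (normalised-pencil (counted-normalised {planeThrough a b} c))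
    off-1 : ∀ b → b ≢ 1# → 𝟙[ planeThrough 0# b ] ≡ 0
    off-1 b b≢1 = indicator-false λ c →
      [ 0≢1 , b≢1 ∘ proj₂ ]′ (normalised-pencil (counted-normalised {planeThrough 0# b} c))

  Ñ₁-as-sum : Ñ₁ F μ ≡ ∑ λ b → indicator (does (numRoots F μ b ℕ.≟ 1))
  Ñ₁-as-sum = ≡.trans (length-filterᵇ _ elements) (sumOver-cong elements (≡.cong indicator ∘ b≡0-excluded))
    where
    b≡0-excluded : ∀ b → not (_==_ F b 0#) ∧ does (numRoots F μ b ℕ.≟ 1) ≡ does (numRoots F μ b ℕ.≟ 1)
    b≡0-excluded b with b ≟ 0#
    ... | yes ≡.refl = ≡.sym (dec-false (numRoots F μ 0# ℕ.≟ 1) numRoots-0)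
    ... | no _ = ≡.refl

  numOneBarPlanesThrough≡Ñ₁+π∞ : fromℕ F 9 * μ ≢ 1# →
    numOneBarPlanesThrough F μ ≡ Ñ₁ F μ ℕ.+ indicator (isOneBarPlane F π∞)
  numOneBarPlanesThrough≡Ñ₁+π∞ 9μ≢1 = begin
    numOneBarPlanesThrough F μ
      ≡⟨ count-pencil ⟩
    (∑ λ b → 𝟙[ planeThrough 1# b ]) ℕ.+ 𝟙[ π∞ ]
      ≡⟨ ≡.cong₂ ℕ._+_ (sumOver-cong elements λ b → ≡.cong indicator (≡.trans (counted-pencil b) (pencil-oneBar 9μ≢1 b)))
                       (≡.cong indicator counted-π∞) ⟩
    (∑ λ b → indicator (does (numRoots F μ b ℕ.≟ 1))) ℕ.+ indicator (isOneBarPlane F π∞)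
      ≡⟨ ≡.cong (ℕ._+ indicator (isOneBarPlane F π∞)) Ñ₁-as-sum ⟨
    Ñ₁ F μ ℕ.+ indicator (isOneBarPlane F π∞)
      ∎

mainTheorem11 : (F : FiniteField) → let open FiniteField F in
    5 ≤ order F →
    (μ : Carrier) → ¬ (μ ≡ 0#) → ¬ (μ ≡ 1#) →
    (¬ (order F % 2 ≡ 0) → ¬ (order F % 3 ≡ 0) → ¬ (fromℕ F 9 * μ ≡ 1#)) →
    (IsSquare F μ → numOneBarPlanesThrough F μ ≡ Ñ₁ F μ)
    × (¬ IsSquare F μ → numOneBarPlanesThrough F μ ≡ suc (Ñ₁ F μ))
mainTheorem11 F _ μ _ μ≢1 ninth-excluded =
    (λ square → ≡.trans total (≡.trans (≡.cong (λ b → Ñ₁ F μ ℕ.+ indicator b) (π∞-oneBar-square square))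
                                         (ℕ.+-identityʳ (Ñ₁ F μ))))
  , (λ nonsquare → ≡.trans total (≡.trans (≡.cong (λ b → Ñ₁ F μ ℕ.+ indicator b) (π∞-oneBar-nonsquare nonsquare))
                                            (ℕ.+-comm (Ñ₁ F μ) 1)))
  where
  open PencilThroughℓμ F μ
  total : numOneBarPlanesThrough F μ ≡ Ñ₁ F μ ℕ.+ indicator (isOneBarPlane F π∞)
  total = numOneBarPlanesThrough≡Ñ₁+π∞ (FiniteFieldArithmetic.9*μ≢1 F μ≢1 ninth-excluded)
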